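{- Let $(S,U,A,C)$ be an instance of WSP in which every constraint in $C$ is user-independent. Define a relation $\approx_{ui}$ on the set of eligible plans by $\pi_1\approx_{ui}\pi_2$ if and only if (1) $\mathrm{user}(\pi_1)=\mathrm{user}(\pi_2)$ and $\mathrm{task}(\pi_1)=\mathrm{task}(\pi_2)$, and (2) for all $s,t\in\mathrm{task}(\pi_1)$, $\pi_1(s)=\pi_1(t)$ if and only if $\pi_2(s)=\pi_2(t)$. Then $\approx_{ui}$ is a plan-indistinguishability relation with respect to $C$.
   Context: An instance of WSP is a tuple $(S,U,A,C)$: $S$ a finite set of tasks, $U$ a finite set of users, $A(s)\subseteq U$ the authorization list of $s\in S$, $C$ a set of constraints; a constraint is a pair $(L,\Theta)$ with $L\subseteq S$ and $\Theta$ a set of functions $L\to U$. A plan is a function $\pi:T\to X$ with $T\subseteq S$, $X\subseteq U$, where the sets $\mathrm{task}(\pi)=T$ and $\mathrm{user}(\pi)=X$ are regarded as part of the data of $\pi$ (so $X$ may contain users to which no task is assigned, and $T$ may be empty). $\pi$ satisfies $(L,\Theta)$ if $L\setminus T\neq\emptyset$ or $\pi|_L\in\Theta$; $\pi$ is eligible if it satisfies every constraint in $C$. A constraint $(L,\Theta)$ is user-independent if for every $\theta\in\Theta$ and every permutation $\psi:U\to U$, $\psi\circ\theta\in\Theta$. Two plans $\pi_1,\pi_2$ are disjoint if $\mathrm{task}(\pi_1)\cap\mathrm{task}(\pi_2)=\emptyset$ and $\mathrm{user}(\pi_1)\cap\mathrm{user}(\pi_2)=\emptyset$; their union $\pi_1\cup\pi_2$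 is the plan with task set $\mathrm{task}(\pi_1)\cup\mathrm{task}(\pi_2)$, user set $\mathrm{user}(\pi_1)\cup\mathrm{user}(\pi_2)$, agreeing with $\pi_i$ on $\mathrm{task}(\pi_i)$. Two eligible plans $\pi_1,\pi_2$ are extension-equivalent if $\mathrm{user}(\pi_1)=\mathrm{user}(\pi_2)$, $\mathrm{task}(\pi_1)=\mathrm{task}(\pi_2)$, and for every plan $\pi'$ disjoint from both, $\pi_1\cup\pi'$ is eligible iff $\pi_2\cup\pi'$ is eligible. A plan-indistinguishability relation with respect to $C$ is an equivalence relation $\approx$ on the set of eligible plans that refines extension-equivalence (every $\approx$-class lies in an extension-equivalence class) and such that whenever $\pi_1\approx\pi_2$ are eligible and $\pi'$ is a plan disjoint from both with $\pi_1\cup\pi'$ eligible, we have $\pi_1\cup\pi'\approx\pi_2\cup\pi'$. -}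

module Defs where

open import Data.Nat using (ℕ)
open import Data.Fin using (Fin)
open import Data.Fin.Subset using (Subset; _∈_; _∉_; _∪_)
open import Data.Fin.Subset.Properties using (_∈?_; x∈p∪q⁻; p⊆p∪q; q⊆p∪q)
open import Data.Fin.Permutation using (Permutation′; _⟨$⟩ʳ_)
open import Data.List using (List)
open import Data.List.Relation.Unary.All using (All)
open import Data.Product using (Σ; ∃; _×_; _,_)
open import Data.Sum using (_⊎_; inj₁; inj₂)
open import Relation.Nullary using (yes; no)
open import Data.Empty using (⊥-elim)
open import Relation.Binary.PropositionalEquality using (_≡_)
open import Function.Bundles using (_⇔_)

-- Tasks S = Fin k, users U = Fin n.

-- A constraint (L, Θ): L ⊆ S, Θ a set of functions L → U.
-- Θ is encoded as a predicate on total functions S → U which only depends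
-- on the values on L (field 'respects'), i.e. exactly a set of functions L → U.
record Constraint (k n : ℕ) : Set₁ where
  field
    scope    : Subset k
    Θ        : (Fin k → Fin n) → Set
    respects : ∀ (f g : Fin k → Fin n) →
               (∀ s → s ∈ scope → f s ≡ g s) → Θ f → Θ g
open Constraint public

record WSP (k n : ℕ) : Set₁ where
  field
    auth        : Fin k → Subset n
    constraints : List (Constraint k n)
open WSP public

UserIndependent : ∀ {k n} → Constraint k n → Set
UserIndependent {k} {n} c =
  ∀ (θ : Fin k → Fin n) → Θ c θ → ∀ (ψ : Permutation′ n) →
  Θ c (λ s → ψ ⟨$⟩ʳ (θ s))

-- A plan π : T → X with T ⊆ S, X ⊆ U as data.  The function is represented
-- by a total function S → U; only its values on T are meaningful.
record Plan (k n : ℕ) : Set where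
  field
    task  : Subset k
    user  : Subset n
    fun   : Fin k → Fin n
    maps  : ∀ s → s ∈ task → fun s ∈ user
open Plan public

PlanEq : ∀ {k n} → Plan k n → Plan k n → Set
PlanEq π₁ π₂ = task π₁ ≡ task π₂ × user π₁ ≡ user π₂ ×
               (∀ s → s ∈ task π₁ → fun π₁ s ≡ fun π₂ s)

Satisfies : ∀ {k n} → Plan k n → Constraint k n → Set
Satisfies π c = (∃ λ s → s ∈ scope c × s ∉ task π) ⊎ Θ c (fun π)

Eligible : ∀ {k n} → List (Constraint k n) → Plan k n → Set₁
Eligible C π = All (Satisfies π) C

Disjoint : ∀ {k n} → Plan k n → Plan k n → Set
Disjoint π₁ π₂ = (∀ s → s ∈ task π₁ → s ∉ task π₂) ×
                 (∀ u → u ∈ user π₁ → u ∉ user π₂)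

private
  unionFun : ∀ {k n} → Plan k n → Plan k n → Fin k → Fin n
  unionFun π₁ π₂ s with s ∈? task π₁
  ... | yes _ = fun π₁ s
  ... | no  _ = fun π₂ s

  unionMaps : ∀ {k n} (π₁ π₂ : Plan k n) s → s ∈ task π₁ ∪ task π₂ →
              unionFun π₁ π₂ s ∈ user π₁ ∪ user π₂
  unionMaps π₁ π₂ s s∈ with s ∈? task π₁
  ... | yes p = p⊆p∪q (user π₂) (maps π₁ s p)
  ... | no ¬p with x∈p∪q⁻ (task π₁) (task π₂) s∈
  ...   | inj₁ p = ⊥-elim (¬p p)
  ...   | inj₂ q = q⊆p∪q (user π₁) (user π₂) (maps π₂ s q)

-- union of plans (meaningful for disjoint plans): agrees with π₁ on task π₁
-- and with π₂ on task π₂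
_⊔_ : ∀ {k n} → Plan k n → Plan k n → Plan k n
π₁ ⊔ π₂ = record
  { task = task π₁ ∪ task π₂
  ; user = user π₁ ∪ user π₂
  ; fun  = unionFun π₁ π₂
  ; maps = unionMaps π₁ π₂
  }

ExtEquiv : ∀ {k n} → List (Constraint k n) → Plan k n → Plan k n → Set₁
ExtEquiv {k} {n} C π₁ π₂ =
  user π₁ ≡ user π₂ × task π₁ ≡ task π₂ ×
  (∀ (π' : Plan k n) → Disjoint π₁ π' → Disjoint π₂ π' →
     (Eligible C (π₁ ⊔ π') ⇔ Eligible C (π₂ ⊔ π')))

record IsPlanIndist {k n : ℕ} (C : List (Constraint k n))
                    (R : Plan k n → Plan k n → Set) : Set₁ where
  field
    -- equivalence relation on eligible plans (reflexivity up to plan equality)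
    refl'   : ∀ π₁ π₂ → Eligible C π₁ → Eligible C π₂ → PlanEq π₁ π₂ → R π₁ π₂
    sym'    : ∀ π₁ π₂ → Eligible C π₁ → Eligible C π₂ → R π₁ π₂ → R π₂ π₁
    trans'  : ∀ π₁ π₂ π₃ → Eligible C π₁ → Eligible C π₂ → Eligible C π₃ →
              R π₁ π₂ → R π₂ π₃ → R π₁ π₃
    refines : ∀ π₁ π₂ → Eligible C π₁ → Eligible C π₂ → R π₁ π₂ →
              ExtEquiv C π₁ π₂
    extend  : ∀ π₁ π₂ π' → Eligible C π₁ → Eligible C π₂ → R π₁ π₂ →
              Disjoint π₁ π' → Disjoint π₂ π' → Eligible C (π₁ ⊔ π') →
              R (π₁ ⊔ π') (π₂ ⊔ π')

_≈ui_ : ∀ {k n} → Plan k n → Plan k n → Set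
π₁ ≈ui π₂ = user π₁ ≡ user π₂ × task π₁ ≡ task π₂ ×
  (∀ s t → s ∈ task π₁ → t ∈ task π₁ →
     (fun π₁ s ≡ fun π₁ t ⇔ fun π₂ s ≡ fun π₂ t))

-- Two plans related by ≈ui differ only by a renaming of users on their common
-- task set, and that renaming extends to a permutation of all users; a
-- user-independent constraint cannot see it, so ≈ui-related plans satisfy the
-- same constraints.  Adding a disjoint plan preserves ≈ui, because a task of one
-- plan and a task of the other never share a user.
module Submission where

open import Defs
open import Data.Nat using (ℕ)
open import Data.Fin using (Fin)
open import Data.Fin.Properties using (_≟_; any?)
open import Data.Fin.Subset using (_∈_; _∉_; _∪_)
open import Data.Fin.Subset.Properties using (_∈?_; x∈p∪q⁻)
open import Data.Fin.Permutation
  using (Permutation′; _⟨$⟩ʳ_; _∘ₚ_; transpose) renaming (id to idₚ)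
import Data.Fin.Permutation.Components as PC
open import Data.List using (List; []; _∷_; filter; allFin)
open import Data.List.Relation.Unary.All as All using (All)
open import Data.List.Relation.Unary.Any using (here; there)
open import Data.List.Membership.Propositional using () renaming (_∈_ to _∈ₗ_)
open import Data.List.Membership.Propositional.Properties
  using (∈-allFin; ∈-filter⁺; ∈-filter⁻)
open import Data.Product using (∃; _×_; _,_; proj₁; proj₂)
open import Data.Sum using (inj₁; inj₂)
open import Data.Empty using (⊥-elim)
open import Relation.Nullary using (yes; no)
open import Relation.Nullary.Decidable using (_×-dec_; ¬?; decidable-stable)
open import Relation.Binary.PropositionalEquality
open import Function using (_∘_)
open import Function.Bundles using (_⇔_; mk⇔; Equivalence; Injection)
open import Function.Properties.Equivalence using () renaming (sym to ⇔-sym; trans to ⇔-trans)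
open import Function.Properties.Inverse using (↔⇒↣)

open Equivalence
open ≡-Reasoning

transpose-matchˡ : ∀ {n} (i j : Fin n) → PC.transpose i j i ≡ j
transpose-matchˡ i j with i ≟ i
... | yes _  = refl
... | no i≢i = ⊥-elim (i≢i refl)

transpose-fixed : ∀ {n} (i j k : Fin n) → (k ≡ i ⇔ k ≡ j) → PC.transpose i j k ≡ k
transpose-fixed i j k k≡i⇔k≡j with k ≟ i
... | yes k≡i = sym (to k≡i⇔k≡j k≡i)
... | no  k≢i with k ≟ j
...   | yes k≡j = ⊥-elim (k≢i (from k≡i⇔k≡j k≡j))
...   | no  _   = refl

permutation-injective : ∀ {n} (ψ : Permutation′ n) {x y} → ψ ⟨$⟩ʳ x ≡ ψ ⟨$⟩ʳ y → x ≡ y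
permutation-injective ψ = Injection.injective (↔⇒↣ ψ)

-- The new point is sent to its target by a transposition, which fixes every
-- earlier target because f and g identify the same points.
matchingPermutation : ∀ {a} {A : Set a} {n} (f g : A → Fin n) (xs : List A) →
  (∀ {x y} → x ∈ₗ xs → y ∈ₗ xs → (f x ≡ f y ⇔ g x ≡ g y)) →
  ∃ λ (ψ : Permutation′ n) → ∀ {x} → x ∈ₗ xs → ψ ⟨$⟩ʳ f x ≡ g x
matchingPermutation f g [] _ = idₚ , λ ()
matchingPermutation f g (x ∷ xs) coincide
  with matchingPermutation f g xs (λ y∈ z∈ → coincide (there y∈) (there z∈))
... | ψ , ψ-match = ψ ∘ₚ transpose (ψ ⟨$⟩ʳ f x) (g x) , match
  where
  match : ∀ {y} → y ∈ₗ x ∷ xs → PC.transpose (ψ ⟨$⟩ʳ f x) (g x) (ψ ⟨$⟩ʳ f y) ≡ g y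
  match (here refl) = transpose-matchˡ (ψ ⟨$⟩ʳ f x) (g x)
  match {y} (there y∈) = begin
    PC.transpose (ψ ⟨$⟩ʳ f x) (g x) (ψ ⟨$⟩ʳ f y) ≡⟨ cong (PC.transpose _ _) (ψ-match y∈) ⟩
    PC.transpose (ψ ⟨$⟩ʳ f x) (g x) (g y)         ≡⟨ transpose-fixed _ _ _ (mk⇔ to′ from′) ⟩
    g y                                           ∎
    where
    to′ : g y ≡ ψ ⟨$⟩ʳ f x → g y ≡ g x
    to′ e = to (coincide (there y∈) (here refl))
               (permutation-injective ψ (trans (ψ-match y∈) e))
    from′ : g y ≡ g x → g y ≡ ψ ⟨$⟩ʳ f x
    from′ e = trans (sym (ψ-match y∈)) (cong (ψ ⟨$⟩ʳ_) (from (coincide (there y∈) (here refl)) e))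

module _ {k n : ℕ} where

  -- π₁ ≈ui π₂ is definitionally user π₁ ≡ user π₂ × SamePattern π₁ π₂.
  SamePattern : Plan k n → Plan k n → Set
  SamePattern π₁ π₂ = task π₁ ≡ task π₂ ×
    (∀ s t → s ∈ task π₁ → t ∈ task π₁ → (fun π₁ s ≡ fun π₁ t ⇔ fun π₂ s ≡ fun π₂ t))

  SamePattern-refl : ∀ π₁ π₂ → PlanEq π₁ π₂ → SamePattern π₁ π₂
  SamePattern-refl _ _ (te , _ , agree) = te , λ s t s∈ t∈ →
    mk⇔ (subst₂ _≡_ (agree s s∈) (agree t t∈))
        (subst₂ _≡_ (sym (agree s s∈)) (sym (agree t t∈)))

  SamePattern-sym : ∀ π₁ π₂ → SamePattern π₁ π₂ → SamePattern π₂ π₁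
  SamePattern-sym _ _ (te , coincide) = sym te , λ s t s∈ t∈ →
    ⇔-sym (coincide s t (subst (s ∈_) (sym te) s∈) (subst (t ∈_) (sym te) t∈))

  SamePattern-trans : ∀ π₁ π₂ π₃ → SamePattern π₁ π₂ → SamePattern π₂ π₃ → SamePattern π₁ π₃
  SamePattern-trans _ _ _ (te₁₂ , coincide₁₂) (te₂₃ , coincide₂₃) = trans te₁₂ te₂₃ , λ s t s∈ t∈ →
    ⇔-trans (coincide₁₂ s t s∈ t∈) (coincide₂₃ s t (subst (s ∈_) te₁₂ s∈) (subst (t ∈_) te₁₂ t∈))

  SamePattern⇒permutation : ∀ π₁ π₂ → SamePattern π₁ π₂ →
    ∃ λ (ψ : Permutation′ n) → ∀ s → s ∈ task π₁ → ψ ⟨$⟩ʳ fun π₁ s ≡ fun π₂ s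
  SamePattern⇒permutation π₁ π₂ (_ , coincide)
    with matchingPermutation (fun π₁) (fun π₂) (filter (_∈? task π₁) (allFin k))
           (λ s∈ t∈ → coincide _ _ (proj₂ (∈-filter⁻ (_∈? task π₁) {xs = allFin k} s∈))
                                  (proj₂ (∈-filter⁻ (_∈? task π₁) {xs = allFin k} t∈)))
  ... | ψ , match = ψ , λ s s∈ → match (∈-filter⁺ (_∈? task π₁) (∈-allFin s) s∈)

  Satisfies-respects-SamePattern : ∀ {c} π₁ π₂ → UserIndependent c → SamePattern π₁ π₂ →
    Satisfies π₁ c → Satisfies π₂ c
  Satisfies-respects-SamePattern _ _ _ (te , _) (inj₁ (s , s∈L , s∉T)) = inj₁ (s , s∈L , subst (s ∉_) te s∉T)
  Satisfies-respects-SamePattern {c} π₁ π₂ ui same@(te , _) (inj₂ θ₁)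
    with any? (λ s → s ∈? scope c ×-dec ¬? (s ∈? task π₂))
  ... | yes unassigned = inj₁ unassigned
  ... | no  none with SamePattern⇒permutation π₁ π₂ same
  ...   | ψ , match = inj₂ (respects c _ _ agree (ui (fun π₁) θ₁ ψ))
    where
    scope⊆task : ∀ s → s ∈ scope c → s ∈ task π₁
    scope⊆task s s∈L = subst (s ∈_) (sym te)
      (decidable-stable (s ∈? task π₂) (λ s∉ → none (s , s∈L , s∉)))
    agree : ∀ s → s ∈ scope c → ψ ⟨$⟩ʳ fun π₁ s ≡ fun π₂ s
    agree s s∈L = match s (scope⊆task s s∈L)

  Eligible-respects-SamePattern : ∀ {C} π₁ π₂ → All UserIndependent C → SamePattern π₁ π₂ →
    Eligible C π₁ → Eligible C π₂
  Eligible-respects-SamePattern π₁ π₂ uis same elig =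
    All.zipWith (λ {c} (ui , sat) → Satisfies-respects-SamePattern {c} π₁ π₂ ui same sat) (uis , elig)

  ⊔-fun-left : ∀ (π π' : Plan k n) {s} → s ∈ task π → fun (π ⊔ π') s ≡ fun π s
  ⊔-fun-left π π' {s} s∈ with s ∈? task π
  ... | yes _  = refl
  ... | no s∉ = ⊥-elim (s∉ s∈)

  ⊔-fun-right : ∀ (π π' : Plan k n) {s} → s ∉ task π → fun (π ⊔ π') s ≡ fun π' s
  ⊔-fun-right π π' {s} s∉ with s ∈? task π
  ... | yes s∈ = ⊥-elim (s∉ s∈)
  ... | no _   = refl

  ∈-⊔-right : ∀ (π π' : Plan k n) {s} → s ∈ task (π ⊔ π') → s ∉ task π → s ∈ task π'
  ∈-⊔-right π π' s∈ s∉ with x∈p∪q⁻ (task π) (task π') s∈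
  ... | inj₁ s∈π  = ⊥-elim (s∉ s∈π)
  ... | inj₂ s∈π' = s∈π'

  Disjoint-separates : ∀ (π π' : Plan k n) {s t} → Disjoint π π' → s ∈ task π → t ∈ task π' → fun π s ≢ fun π' t
  Disjoint-separates π π' {s} {t} (_ , users-disjoint) s∈ t∈ e =
    users-disjoint _ (maps π s s∈) (subst (_∈ user π') (sym e) (maps π' t t∈))

  ⊔-transfers-coincidence : ∀ π₁ π₂ π' → SamePattern π₁ π₂ → Disjoint π₁ π' →
    ∀ {s t} → s ∈ task (π₁ ⊔ π') → t ∈ task (π₁ ⊔ π') →
    fun (π₁ ⊔ π') s ≡ fun (π₁ ⊔ π') t → fun (π₂ ⊔ π') s ≡ fun (π₂ ⊔ π') t
  -- Splitting on s ∈? task π₁ also reduces fun (π₁ ⊔ π') in the type of e.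
  ⊔-transfers-coincidence π₁ π₂ π' (te , coincide) disjoint {s} {t} s∈ t∈ e
    with s ∈? task π₁ | t ∈? task π₁
  ... | yes s∈₁ | yes t∈₁ = begin
    fun (π₂ ⊔ π') s  ≡⟨ ⊔-fun-left π₂ π' (subst (s ∈_) te s∈₁) ⟩
    fun π₂ s         ≡⟨ to (coincide s t s∈₁ t∈₁) e ⟩
    fun π₂ t         ≡⟨ ⊔-fun-left π₂ π' (subst (t ∈_) te t∈₁) ⟨
    fun (π₂ ⊔ π') t  ∎
  ... | yes s∈₁ | no t∉₁ = ⊥-elim (Disjoint-separates π₁ π' disjoint s∈₁ (∈-⊔-right π₁ π' t∈ t∉₁) e)
  ... | no s∉₁ | yes t∈₁ = ⊥-elim (Disjoint-separates π₁ π' disjoint t∈₁ (∈-⊔-right π₁ π' s∈ s∉₁) (sym e))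
  ... | no s∉₁ | no t∉₁ = begin
    fun (π₂ ⊔ π') s  ≡⟨ ⊔-fun-right π₂ π' (s∉₁ ∘ subst (s ∈_) (sym te)) ⟩
    fun π' s         ≡⟨ e ⟩
    fun π' t         ≡⟨ ⊔-fun-right π₂ π' (t∉₁ ∘ subst (t ∈_) (sym te)) ⟨
    fun (π₂ ⊔ π') t  ∎

  SamePattern-⊔ : ∀ π₁ π₂ π' → SamePattern π₁ π₂ → Disjoint π₁ π' → Disjoint π₂ π' →
    SamePattern (π₁ ⊔ π') (π₂ ⊔ π')
  SamePattern-⊔ π₁ π₂ π' same@(te , _) disjoint₁ disjoint₂ = te⊔ , λ s t s∈ t∈ →
    mk⇔ (⊔-transfers-coincidence π₁ π₂ π' same disjoint₁ s∈ t∈)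
        (⊔-transfers-coincidence π₂ π₁ π' (SamePattern-sym π₁ π₂ same) disjoint₂
           (subst (s ∈_) te⊔ s∈) (subst (t ∈_) te⊔ t∈))
    where te⊔ = cong (_∪ task π') te

lemma4 : ∀ {k n} (W : WSP k n) → All UserIndependent (constraints W) →
    IsPlanIndist (constraints W) _≈ui_
lemma4 W uis = record
  { refl'   = λ π₁ π₂ _ _ eq@(_ , ue , _) → ue , SamePattern-refl π₁ π₂ eq
  ; sym'    = λ π₁ π₂ _ _ (ue , same) → sym ue , SamePattern-sym π₁ π₂ same
  ; trans'  = λ π₁ π₂ π₃ _ _ _ (ue₁₂ , same₁₂) (ue₂₃ , same₂₃) →
      trans ue₁₂ ue₂₃ , SamePattern-trans π₁ π₂ π₃ same₁₂ same₂₃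
  ; refines = λ π₁ π₂ _ _ (ue , same) → ue , proj₁ same , λ π' disjoint₁ disjoint₂ →
      mk⇔ (Eligible-respects-SamePattern (π₁ ⊔ π') (π₂ ⊔ π') uis
             (SamePattern-⊔ π₁ π₂ π' same disjoint₁ disjoint₂))
          (Eligible-respects-SamePattern (π₂ ⊔ π') (π₁ ⊔ π') uis
             (SamePattern-⊔ π₂ π₁ π' (SamePattern-sym π₁ π₂ same) disjoint₂ disjoint₁))
  ; extend  = λ π₁ π₂ π' _ _ (ue , same) disjoint₁ disjoint₂ _ →
      cong (_∪ user π') ue , SamePattern-⊔ π₁ π₂ π' same disjoint₁ disjoint₂
  }
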